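{- Let $K$ be a field, $A$ a free abelian group of finite rank, and $W:A\to K$ an elliptic net such that $\Lambda=W^{ -1}(0)$ is a subgroup of $A$ with $|A/\Lambda|\ge4$. Define $\delta:\Lambda\times(A\setminus\Lambda)\to K^\times$ by $\delta(\boldsymbol\lambda,\mathbf v)=W(\boldsymbol\lambda+\mathbf v)/W(\mathbf v)$. Then for all $\boldsymbol\lambda\in\Lambda$ and all $\mathbf a,\mathbf b,\mathbf c,\mathbf d\in A\setminus\Lambda$ with $\mathbf a+\mathbf b=\mathbf c+\mathbf d$, $$\delta(\boldsymbol\lambda,\mathbf a)\delta(\boldsymbol\lambda,\mathbf b)=\delta(\boldsymbol\lambda,\mathbf c)\delta(\boldsymbol\lambda,\mathbf d).$$
   Context: An elliptic net is a map $W:A\to K$ with $W(\mathbf 0)=0$ and $W(\mathbf p+\mathbf q+\mathbf s)W(\mathbf p-\mathbf q)W(\mathbf r+\mathbf s)W(\mathbf r)+W(\mathbf q+\mathbf r+\mathbf s)W(\mathbf q-\mathbf r)W(\mathbf p+\mathbf s)W(\mathbf p)+W(\mathbf r+\mathbf p+\mathbf s)W(\mathbf r-\mathbf p)W(\mathbf q+\mathbf s)W(\mathbf q)=0$ for all $\mathbf p,\mathbf q,\mathbf r,\mathbf s\in A$. -}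

module Defs where

open import Level using (Level; suc; _⊔_)
open import Algebra.Bundles using (CommutativeRing)
open import Data.Nat using (ℕ)
open import Data.Integer as ℤ using (ℤ)
open import Data.Fin using (Fin)
open import Data.Vec using (Vec; zipWith; replicate; map)
open import Data.Product using (Σ; _×_)
open import Relation.Nullary using (¬_)
open import Relation.Binary.PropositionalEquality using (_≡_; _≢_)

record Field (c ℓ : Level) : Set (suc (c ⊔ ℓ)) where
  field
    commutativeRing : CommutativeRing c ℓ
  open CommutativeRing commutativeRing public
  field
    0≉1     : ¬ (0# ≈ 1#)
    _⁻¹     : (x : Carrier) → ¬ (x ≈ 0#) → Carrier
    inverse : (x : Carrier) (x≉0 : ¬ (x ≈ 0#)) → x * (x ⁻¹) x≉0 ≈ 1#

A : ℕ → Set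
A n = Vec ℤ n

_⊕_ : ∀ {n} → A n → A n → A n
_⊕_ = zipWith ℤ._+_

⊖_ : ∀ {n} → A n → A n
⊖_ = map (λ z → ℤ.- z)

_⊝_ : ∀ {n} → A n → A n → A n
x ⊝ y = x ⊕ (⊖ y)

𝟎 : ∀ {n} → A n
𝟎 {n} = replicate n (ℤ.+ 0)

infixl 6 _⊕_ _⊝_
infix 8 ⊖_

module _ {c ℓ} (K : Field c ℓ) where
  open Field K

  record IsEllipticNet {n : ℕ} (W : A n → Carrier) : Set (c ⊔ ℓ) where
    field
      W𝟎 : W 𝟎 ≈ 0#
      recurrence : ∀ (p q r s : A n) →
        (W (p ⊕ q ⊕ s) * W (p ⊝ q) * W (r ⊕ s) * W r)
        + (W (q ⊕ r ⊕ s) * W (q ⊝ r) * W (p ⊕ s) * W p)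
        + (W (r ⊕ p ⊕ s) * W (r ⊝ p) * W (q ⊕ s) * W q)
        ≈ 0#

  ZeroSet : {n : ℕ} (W : A n → Carrier) → A n → Set ℓ
  ZeroSet W x = W x ≈ 0#

  ZeroSetIsSubgroup : {n : ℕ} (W : A n → Carrier) → Set ℓ
  ZeroSetIsSubgroup W =
    ZeroSet W 𝟎 ×
    (∀ x y → ZeroSet W x → ZeroSet W y → ZeroSet W (x ⊕ y)) ×
    (∀ x → ZeroSet W x → ZeroSet W (⊖ x))

  -- |A/Λ| ≥ 4 : there are 4 pairwise distinct cosets of Λ
  IndexAtLeast4 : {n : ℕ} (W : A n → Carrier) → Set ℓ
  IndexAtLeast4 {n} W =
    Σ (Fin 4 → A n) λ x → ∀ i j → i ≢ j → ¬ ZeroSet W (x i ⊝ x j)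

  δ : {n : ℕ} (W : A n → Carrier) (λ' v : A n) → ¬ ZeroSet W v → Carrier
  δ W λ' v v∉Λ = W (λ' ⊕ v) * (W v ⁻¹) v∉Λ

{-# OPTIONS --safe #-}
module Submission where

-- Take r = λ in the elliptic net recurrence: the first term dies because W(λ) = 0, and with
-- p = λ + b, q = λ + c, s = a − q the other two become W(λ+a)W(c)W(d)W(λ+b) and
-- W(λ+d)W(−b)W(a)W(λ+c).  The case λ = 0, a = b = c = d = x shows that W is odd off Λ, so the
-- two terms agree, which is the claim after clearing denominators.  Neither that Λ is a
-- subgroup nor that its index is at least 4 is needed.

open import Level using (Level; 0ℓ)
open import Algebra.Bundles using (AbelianGroup)
open import Data.Nat using (ℕ)
import Data.Integer.Properties as ℤ
open import Data.Vec.Properties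
  using (zipWith-assoc; zipWith-identityˡ; zipWith-identityʳ; zipWith-inverseˡ; zipWith-inverseʳ; zipWith-comm)
open import Data.Product using (_,_)
open import Relation.Nullary using (¬_)
open import Relation.Binary.PropositionalEquality as ≡ using (_≡_)
open import Defs

ℤⁿ-+-abelianGroup : ℕ → AbelianGroup 0ℓ 0ℓ
ℤⁿ-+-abelianGroup n = record
  { Carrier = A n
  ; _≈_ = _≡_
  ; _∙_ = _⊕_
  ; ε = 𝟎
  ; _⁻¹ = ⊖_
  ; isAbelianGroup = record
    { isGroup = record
      { isMonoid = record
        { isSemigroup = record
          { isMagma = record { isEquivalence = ≡.isEquivalence ; ∙-cong = ≡.cong₂ _⊕_ }
          ; assoc = zipWith-assoc ℤ.+-assoc
          }
        ; identity = zipWith-identityˡ ℤ.+-identityˡ , zipWith-identityʳ ℤ.+-identityʳ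
        }
      ; inverse = zipWith-inverseˡ ℤ.+-inverseˡ , zipWith-inverseʳ ℤ.+-inverseʳ
      ; ⁻¹-cong = ≡.cong ⊖_
      }
    ; comm = zipWith-comm ℤ.+-comm
    }
  }

module AbelianGroupIdentities {a ℓ} (G : AbelianGroup a ℓ) where
  open AbelianGroup G
  open import Algebra.Properties.AbelianGroup G
  open import Algebra.Properties.CommutativeSemigroup commutativeSemigroup
  open import Relation.Binary.Reasoning.Setoid setoid

  x∙yx⁻¹≈y : ∀ x y → x ∙ (y ∙ x ⁻¹) ≈ y
  x∙yx⁻¹≈y x y = begin
    x ∙ (y ∙ x ⁻¹)  ≈⟨ x∙yz≈y∙xz x y (x ⁻¹) ⟩
    y ∙ (x ∙ x ⁻¹)  ≈⟨ ∙-congˡ (inverseʳ x) ⟩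
    y ∙ ε           ≈⟨ identityʳ y ⟩
    y               ∎

  xy∙zx⁻¹≈y∙z : ∀ x y z → (x ∙ y) ∙ (z ∙ x ⁻¹) ≈ y ∙ z
  xy∙zx⁻¹≈y∙z x y z = trans (xy∙z≈y∙xz x y _) (∙-congˡ (x∙yx⁻¹≈y x z))

  x∙[xy]⁻¹≈y⁻¹ : ∀ x y → x ∙ (x ∙ y) ⁻¹ ≈ y ⁻¹
  x∙[xy]⁻¹≈y⁻¹ x y = begin
    x ∙ (x ∙ y) ⁻¹     ≈⟨ ∙-congˡ (⁻¹-∙-comm x y) ⟨
    x ∙ (x ⁻¹ ∙ y ⁻¹)  ≈⟨ \\-leftDividesˡ x (y ⁻¹) ⟩
    y ⁻¹               ∎

  zy≈wv⇒xy∙z[xw]⁻¹≈v : ∀ x y z w v → z ∙ y ≈ w ∙ v → (x ∙ y) ∙ (z ∙ (x ∙ w) ⁻¹) ≈ v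
  zy≈wv⇒xy∙z[xw]⁻¹≈v x y z w v zy≈wv = begin
    (x ∙ y) ∙ (z ∙ (x ∙ w) ⁻¹)  ≈⟨ x∙yz≈yx∙z (x ∙ y) z _ ⟩
    (z ∙ (x ∙ y)) ∙ (x ∙ w) ⁻¹  ≈⟨ ∙-congʳ (x∙yz≈y∙xz z x y) ⟩
    (x ∙ (z ∙ y)) ∙ (x ∙ w) ⁻¹  ≈⟨ ∙-congʳ (∙-congˡ zy≈wv) ⟩
    (x ∙ (w ∙ v)) ∙ (x ∙ w) ⁻¹  ≈⟨ ∙-congʳ (assoc x w v) ⟨
    (x ∙ w) ∙ v ∙ (x ∙ w) ⁻¹    ≈⟨ xyx⁻¹≈y (x ∙ w) v ⟩
    v                           ∎

module FieldProperties {c ℓ} (K : Field c ℓ) where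
  open Field K
  open import Relation.Binary.Reasoning.Setoid setoid
  open import Algebra.Solver.Ring.NaturalCoefficients.Default commutativeSemiring
    using (solve; _:*_; _:=_)

  x*u⁻¹*u≈x : ∀ x u (u≉0 : ¬ u ≈ 0#) → x * (u ⁻¹) u≉0 * u ≈ x
  x*u⁻¹*u≈x x u u≉0 = begin
    x * u⁻¹ * u    ≈⟨ *-assoc x u⁻¹ u ⟩
    x * (u⁻¹ * u)  ≈⟨ *-congˡ (trans (*-comm u⁻¹ u) (inverse u u≉0)) ⟩
    x * 1#         ≈⟨ *-identityʳ x ⟩
    x              ∎
    where u⁻¹ = (u ⁻¹) u≉0

  *-cancelʳ-≉0 : ∀ {x y z} → ¬ z ≈ 0# → x * z ≈ y * z → x ≈ y
  *-cancelʳ-≉0 {x} {y} {z} z≉0 xz≈yz = begin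
    x                    ≈⟨ x*u⁻¹*u≈x x z z≉0 ⟨
    x * z⁻¹ * z          ≈⟨ solve 3 (λ x z z⁻¹ → x :* z⁻¹ :* z := x :* z :* z⁻¹) refl x z z⁻¹ ⟩
    x * z * z⁻¹          ≈⟨ *-congʳ xz≈yz ⟩
    y * z * z⁻¹          ≈⟨ solve 3 (λ y z z⁻¹ → y :* z :* z⁻¹ := y :* z⁻¹ :* z) refl y z z⁻¹ ⟩
    y * z⁻¹ * z          ≈⟨ x*u⁻¹*u≈x y z z≉0 ⟩
    y                    ∎
    where z⁻¹ = (z ⁻¹) z≉0

  x≉0∧y≉0⇒x*y≉0 : ∀ {x y} → ¬ x ≈ 0# → ¬ y ≈ 0# → ¬ x * y ≈ 0#
  x≉0∧y≉0⇒x*y≉0 {x} {y} x≉0 y≉0 xy≈0 = y≉0 (*-cancelʳ-≉0 x≉0 (begin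
    y * x   ≈⟨ *-comm y x ⟩
    x * y   ≈⟨ xy≈0 ⟩
    0#      ≈⟨ zeroˡ x ⟨
    0# * x  ∎))

  quotient-product-cross : ∀ x₁ x₂ y₁ y₂ u₁ u₂ v₁ v₂
    (u₁≉0 : ¬ u₁ ≈ 0#) (u₂≉0 : ¬ u₂ ≈ 0#) (v₁≉0 : ¬ v₁ ≈ 0#) (v₂≉0 : ¬ v₂ ≈ 0#) →
    x₁ * x₂ * (v₁ * v₂) ≈ y₁ * y₂ * (u₁ * u₂) →
    x₁ * (u₁ ⁻¹) u₁≉0 * (x₂ * (u₂ ⁻¹) u₂≉0) ≈ y₁ * (v₁ ⁻¹) v₁≉0 * (y₂ * (v₂ ⁻¹) v₂≉0)
  quotient-product-cross x₁ x₂ y₁ y₂ u₁ u₂ v₁ v₂ u₁≉0 u₂≉0 v₁≉0 v₂≉0 cross =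
    *-cancelʳ-≉0 (x≉0∧y≉0⇒x*y≉0 (x≉0∧y≉0⇒x*y≉0 u₁≉0 u₂≉0) (x≉0∧y≉0⇒x*y≉0 v₁≉0 v₂≉0)) (begin
      f₁ * f₂ * (u₁ * u₂ * (v₁ * v₂))    ≈⟨ rearrange f₁ f₂ u₁ u₂ v₁ v₂ ⟩
      f₁ * u₁ * (f₂ * u₂) * (v₁ * v₂)    ≈⟨ *-congʳ (*-cong (x*u⁻¹*u≈x x₁ u₁ u₁≉0) (x*u⁻¹*u≈x x₂ u₂ u₂≉0)) ⟩
      x₁ * x₂ * (v₁ * v₂)                ≈⟨ cross ⟩
      y₁ * y₂ * (u₁ * u₂)                ≈⟨ *-congʳ (*-cong (x*u⁻¹*u≈x y₁ v₁ v₁≉0) (x*u⁻¹*u≈x y₂ v₂ v₂≉0)) ⟨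
      g₁ * v₁ * (g₂ * v₂) * (u₁ * u₂)    ≈⟨ rearrange g₁ g₂ v₁ v₂ u₁ u₂ ⟨
      g₁ * g₂ * (v₁ * v₂ * (u₁ * u₂))    ≈⟨ *-congˡ (*-comm (v₁ * v₂) (u₁ * u₂)) ⟩
      g₁ * g₂ * (u₁ * u₂ * (v₁ * v₂))    ∎)
    where
    f₁ = x₁ * (u₁ ⁻¹) u₁≉0
    f₂ = x₂ * (u₂ ⁻¹) u₂≉0
    g₁ = y₁ * (v₁ ⁻¹) v₁≉0
    g₂ = y₂ * (v₂ ⁻¹) v₂≉0
    rearrange : ∀ a b p q r s → a * b * (p * q * (r * s)) ≈ a * p * (b * q) * (r * s)
    rearrange = solve 6 (λ a b p q r s →
      a :* b :* (p :* q :* (r :* s)) := a :* p :* (b :* q) :* (r :* s)) refl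

module EllipticNetProperties {c ℓ} (K : Field c ℓ) {n : ℕ} {W : A n → Field.Carrier K}
                             (net : IsEllipticNet K W) where
  open Field K
  open IsEllipticNet net
  open FieldProperties K
  open AbelianGroupIdentities (ℤⁿ-+-abelianGroup n)
  open AbelianGroup (ℤⁿ-+-abelianGroup n) using () renaming (assoc to ⊕-assoc; identityˡ to ⊕-identityˡ)
  open import Algebra.Properties.AbelianGroup (ℤⁿ-+-abelianGroup n) using (xyx⁻¹≈y)
  open import Algebra.Properties.Group +-group using (inverseˡ-unique; inverseʳ-unique; ⁻¹-involutive)
  open import Algebra.Properties.Ring ring using (-‿distribˡ-*)
  open import Relation.Binary.Reasoning.Setoid setoid
  open import Algebra.Solver.Ring.NaturalCoefficients.Default commutativeSemiring
    using (solve; _:+_; _:*_; _:=_)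

  W-cong : ∀ {x y} → x ≡ y → W x ≈ W y
  W-cong x≡y = reflexive (≡.cong W x≡y)

  recurrence-at-zero : ∀ l → W l ≈ 0# → ∀ a b c d → a ⊕ b ≡ c ⊕ d →
    W (l ⊕ a) * W c * W d * W (l ⊕ b) + W (l ⊕ d) * W (⊖ b) * W a * W (l ⊕ c) ≈ 0#
  recurrence-at-zero l Wl≈0 a b c d ab≡cd = begin
    X + Y             ≈⟨ +-cong T₂≈X T₃≈Y ⟨
    T₂ + T₃           ≈⟨ +-congʳ (+-identityˡ T₂) ⟨
    0# + T₂ + T₃      ≈⟨ +-congʳ (+-congʳ T₁≈0) ⟨
    T₁ + T₂ + T₃      ≈⟨ recurrence p q l s ⟩
    0#                ∎
    where
    p = l ⊕ b
    q = l ⊕ c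
    s = a ⊝ q
    T₁ = W (p ⊕ q ⊕ s) * W (p ⊝ q) * W (l ⊕ s) * W l
    T₂ = W (q ⊕ l ⊕ s) * W (q ⊝ l) * W (p ⊕ s) * W p
    T₃ = W (l ⊕ p ⊕ s) * W (l ⊝ p) * W (q ⊕ s) * W q
    X = W (l ⊕ a) * W c * W d * W (l ⊕ b)
    Y = W (l ⊕ d) * W (⊖ b) * W a * W (l ⊕ c)
    p⊕s≡d : p ⊕ s ≡ d
    p⊕s≡d = zy≈wv⇒xy∙z[xw]⁻¹≈v l b a c d ab≡cd
    T₁≈0 : T₁ ≈ 0#
    T₁≈0 = trans (*-congˡ Wl≈0) (zeroʳ _)
    T₂≈X : T₂ ≈ X
    T₂≈X = *-congʳ (*-cong (*-cong (W-cong (xy∙zx⁻¹≈y∙z q l a))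
                                   (W-cong (xyx⁻¹≈y l c)))
                           (W-cong p⊕s≡d))
    T₃≈Y : T₃ ≈ Y
    T₃≈Y = *-congʳ (*-cong (*-cong (W-cong (≡.trans (⊕-assoc l p s) (≡.cong (l ⊕_) p⊕s≡d)))
                                   (W-cong (x∙[xy]⁻¹≈y⁻¹ l b)))
                           (W-cong (x∙yx⁻¹≈y q a)))

  W-odd : ∀ x → ¬ W x ≈ 0# → W (⊖ x) ≈ - W x
  W-odd x Wx≉0 = inverseʳ-unique w v (*-cancelʳ-≉0 w³≉0 (begin
    (w + v) * w³                                  ≈⟨ expand w v ⟩
    w * w * w * w + w * v * w * w                 ≈⟨ +-cong (shift-by-𝟎 w) (shift-by-𝟎 v) ⟨
    w₀ * w * w * w₀ + w₀ * v * w * w₀             ≈⟨ recurrence-at-zero 𝟎 W𝟎 x x x x ≡.refl ⟩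
    0#                                            ≈⟨ zeroˡ w³ ⟨
    0# * w³                                       ∎))
    where
    w = W x
    v = W (⊖ x)
    w₀ = W (𝟎 ⊕ x)
    w³ = w * w * w
    w³≉0 : ¬ w³ ≈ 0#
    w³≉0 = x≉0∧y≉0⇒x*y≉0 (x≉0∧y≉0⇒x*y≉0 Wx≉0 Wx≉0) Wx≉0
    w₀≈w : w₀ ≈ w
    w₀≈w = W-cong (⊕-identityˡ x)
    shift-by-𝟎 : ∀ y → w₀ * y * w * w₀ ≈ w * y * w * w
    shift-by-𝟎 y = *-cong (*-congʳ (*-congʳ w₀≈w)) w₀≈w
    expand : ∀ w v → (w + v) * (w * w * w) ≈ w * w * w * w + w * v * w * w
    expand = solve 2 (λ w v → (w :+ v) :* (w :* w :* w) := w :* w :* w :* w :+ w :* v :* w :* w) refl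

  δ-product-cross-multiplied : ∀ l → W l ≈ 0# → ∀ a b c d → ¬ W b ≈ 0# → a ⊕ b ≡ c ⊕ d →
    W (l ⊕ a) * W (l ⊕ b) * (W c * W d) ≈ W (l ⊕ c) * W (l ⊕ d) * (W a * W b)
  δ-product-cross-multiplied l Wl≈0 a b c d Wb≉0 ab≡cd = begin
    Wla * Wlb * (Wc * Wd)        ≈⟨ regroupˡ Wla Wlb Wc Wd ⟩
    Wla * Wc * Wd * Wlb          ≈⟨ inverseˡ-unique _ _ (recurrence-at-zero l Wl≈0 a b c d ab≡cd) ⟩
    - (Wld * W (⊖ b) * Wa * Wlc) ≈⟨ -‿cong (*-congʳ (*-congʳ (*-congˡ (W-odd b Wb≉0)))) ⟩
    - (Wld * - Wb * Wa * Wlc)    ≈⟨ -‿cong (pull-second Wld (- Wb) Wa Wlc) ⟩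
    - (- Wb * (Wlc * Wld * Wa))  ≈⟨ -‿cong (-‿distribˡ-* Wb _) ⟨
    - - (Wb * (Wlc * Wld * Wa))  ≈⟨ ⁻¹-involutive _ ⟩
    Wb * (Wlc * Wld * Wa)        ≈⟨ regroupʳ Wb Wlc Wld Wa ⟩
    Wlc * Wld * (Wa * Wb)        ∎
    where
    Wa = W a
    Wb = W b
    Wc = W c
    Wd = W d
    Wla = W (l ⊕ a)
    Wlb = W (l ⊕ b)
    Wlc = W (l ⊕ c)
    Wld = W (l ⊕ d)
    regroupˡ : ∀ x y z t → x * y * (z * t) ≈ x * z * t * y
    regroupˡ = solve 4 (λ x y z t → x :* y :* (z :* t) := x :* z :* t :* y) refl
    pull-second : ∀ x y z t → x * y * z * t ≈ y * (t * x * z)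
    pull-second = solve 4 (λ x y z t → x :* y :* z :* t := y :* (t :* x :* z)) refl
    regroupʳ : ∀ x y z t → x * (y * z * t) ≈ y * z * (t * x)
    regroupʳ = solve 4 (λ x y z t → x :* (y :* z :* t) := y :* z :* (t :* x)) refl

lemma4p1 : ∀ {c ℓ : Level} (K : Field c ℓ) (n : ℕ) (W : A n → Field.Carrier K) →
    IsEllipticNet K W → ZeroSetIsSubgroup K W → IndexAtLeast4 K W →
    ∀ (λ' : A n) → ZeroSet K W λ' →
    ∀ (a b c d : A n) (a∉ : ¬ ZeroSet K W a) (b∉ : ¬ ZeroSet K W b)
      (c∉ : ¬ ZeroSet K W c) (d∉ : ¬ ZeroSet K W d) →
    a ⊕ b ≡ c ⊕ d →
    Field._≈_ K (Field._*_ K (δ K W λ' a a∉) (δ K W λ' b b∉))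
                (Field._*_ K (δ K W λ' c c∉) (δ K W λ' d d∉))
lemma4p1 K n W net _ _ λ' λ'∈Λ a b c d a∉ b∉ c∉ d∉ ab≡cd =
  FieldProperties.quotient-product-cross K _ _ _ _ (W a) (W b) (W c) (W d) a∉ b∉ c∉ d∉
    (EllipticNetProperties.δ-product-cross-multiplied K net λ' λ'∈Λ a b c d b∉ ab≡cd)
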